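{- Let $n=p_1p_2p_3$ ($p_i$ distinct primes), $\gcd(n,6)=1$, $n>1000$, $G$ cyclic of order $n$, $\mathrm{ord}(g)=n$. Let $a,b,c$ be integers with $1+c=a+b$ and $1<c<\frac n2<n-b\le n-a<n-1$, such that $S=(g)\cdot(cg)\cdot((n-b)g)\cdot((n-a)g)$ is a reduced minimal zero-sum sequence and one of (A2), (A3), (A4) below holds. Let $s=\lfloor b/a\rfloor$ and assume $s\le9$ and condition (B). Let $k_1$ be as defined below, and suppose $\lceil\frac nc\rceil=\lceil\frac nb\rceil$ and $k_1\le\frac ba$. Then $k_1\le6$.
   Context: Minimal zero-sum sequence: a finite unordered sequence of elements of $G$ whose terms sum to $0$ and no proper nonempty subsequence of which sums to $0$. $S$ is reduced if for every prime $p\mid n$ the sequence $(pg)\cdot(pcg)\cdot(p(n-b)g)\cdot(p(n-a)g)$ is not minimal zero-sum. Conditions (for a suitable labeling of the primes): (A2) $\{\gcd(c,n),\gcd(b,n),\gcd(a,n)\}=\{p_1,p_2,p_1p_2\}$; (A3) $\gcd(c+1,n)=p_1p_2$, $\gcd(b-1,n)=p_1p_3$, $\gcd(a-1,n)=p_2p_3$; (A4) $\gcd(c,n)=p_1p_2$, $\gcd(b,n)=p_1p_3$, $\gcd(a,n)=p_2p_3$. Condition (B): for every integer $t$ with $0\le t\le\lfloor s/2\rfloor-1$, the interval $[\frac{(2s-2t-1)n}{2b},\frac{(s-t)n}{b}]$ contains no integer coprime to $n$. $k_1$ is the largest positive integer such that $\lceil\frac{(k_1-1)n}{c}\rceil=\lceil\frac{(k_1-1)n}{b}\rceil$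 and there is an integer $m$ with $\frac{k_1n}{c}\le m<\frac{k_1n}{b}$. -}

module Defs where

open import Data.Nat using (ℕ; zero; suc; _+_; _*_; _∸_; _≤_; _<_; _/_)
open import Data.Nat.Divisibility using (_∣_)
open import Data.Nat.GCD using (gcd)
open import Data.Nat.Primality using (Prime)
open import Data.Nat.Coprimality using (Coprime)
open import Data.List using (List; []; _∷_; length)
open import Data.Nat.ListAction using (sum)
open import Data.List.Relation.Binary.Sublist.Propositional using (_⊆_)
open import Data.Product using (_×_; ∃)
open import Data.Sum using (_⊎_)
open import Relation.Binary.PropositionalEquality using (_≡_)
open import Relation.Nullary using (¬_)

-- The cyclic group G of order n is modelled as ℤ/nℤ; an element is
-- represented by any natural number, two representatives being equal in G
-- iff they are congruent mod n.

-- floor and ceiling of x / d (d > 0 in all uses; value at d = 0 is junk)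
fdiv : ℕ → ℕ → ℕ
fdiv x zero    = zero
fdiv x (suc d) = x / suc d

cdiv : ℕ → ℕ → ℕ
cdiv x zero    = zero
cdiv x (suc d) = (x + d) / suc d

HasOrder : ℕ → ℕ → ℕ → Set
HasOrder n g k = (0 < k) × (n ∣ k * g) × (∀ j → 0 < j → j < k → ¬ (n ∣ j * g))

ZeroSum : ℕ → List ℕ → Set
ZeroSum n xs = n ∣ sum xs

MinimalZeroSum : ℕ → List ℕ → Set
MinimalZeroSum n xs =
  ZeroSum n xs ×
  (∀ ys → ys ⊆ xs → 0 < length ys → length ys < length xs → ¬ ZeroSum n ys)

seqS : ℕ → ℕ → ℕ → ℕ → ℕ → ℕ → List ℕ
seqS n g a b c q = (q * g) ∷ (q * c * g) ∷ (q * (n ∸ b) * g) ∷ (q * (n ∸ a) * g) ∷ []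

Reduced : ℕ → ℕ → ℕ → ℕ → ℕ → Set
Reduced n g a b c = ∀ p → Prime p → p ∣ n → ¬ MinimalZeroSum n (seqS n g a b c p)

Relabel : ℕ → ℕ → ℕ → ℕ → ℕ → ℕ → Set
Relabel p1 p2 p3 q1 q2 q3 =
    (q1 ≡ p1 × q2 ≡ p2 × q3 ≡ p3)
  ⊎ (q1 ≡ p1 × q2 ≡ p3 × q3 ≡ p2)
  ⊎ (q1 ≡ p2 × q2 ≡ p1 × q3 ≡ p3)
  ⊎ (q1 ≡ p2 × q2 ≡ p3 × q3 ≡ p1)
  ⊎ (q1 ≡ p3 × q2 ≡ p1 × q3 ≡ p2)
  ⊎ (q1 ≡ p3 × q2 ≡ p2 × q3 ≡ p1)

In3 : ℕ → ℕ → ℕ → ℕ → Set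
In3 x u v w = x ≡ u ⊎ x ≡ v ⊎ x ≡ w

SetEq3 : ℕ → ℕ → ℕ → ℕ → ℕ → ℕ → Set
SetEq3 x y z u v w =
  (In3 x u v w × In3 y u v w × In3 z u v w) ×
  (In3 u x y z × In3 v x y z × In3 w x y z)

CondA2 : ℕ → ℕ → ℕ → ℕ → ℕ → ℕ → ℕ → Set
CondA2 p1 p2 p3 n a b c = ∃ λ q1 → ∃ λ q2 → ∃ λ q3 → Relabel p1 p2 p3 q1 q2 q3 ×
  SetEq3 (gcd c n) (gcd b n) (gcd a n) q1 q2 (q1 * q2)

CondA3 : ℕ → ℕ → ℕ → ℕ → ℕ → ℕ → ℕ → Set
CondA3 p1 p2 p3 n a b c = ∃ λ q1 → ∃ λ q2 → ∃ λ q3 → Relabel p1 p2 p3 q1 q2 q3 ×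
  (gcd (c + 1) n ≡ q1 * q2 × gcd (b ∸ 1) n ≡ q1 * q3 × gcd (a ∸ 1) n ≡ q2 * q3)

CondA4 : ℕ → ℕ → ℕ → ℕ → ℕ → ℕ → ℕ → Set
CondA4 p1 p2 p3 n a b c = ∃ λ q1 → ∃ λ q2 → ∃ λ q3 → Relabel p1 p2 p3 q1 q2 q3 ×
  (gcd c n ≡ q1 * q2 × gcd b n ≡ q1 * q3 × gcd a n ≡ q2 * q3)

-- Condition (B), with s = ⌊b/a⌋: for every t with 0 ≤ t ≤ ⌊s/2⌋ - 1,
-- no integer m with (2s-2t-1)n/(2b) ≤ m ≤ (s-t)n/b is coprime to n.
-- (Such m are positive, so ranging over ℕ suffices.)
CondB : ℕ → ℕ → ℕ → Set
CondB n a b = ∀ t → t + 1 ≤ fdiv s 2 → ∀ m →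
    (2 * s ∸ 2 * t ∸ 1) * n ≤ 2 * b * m → b * m ≤ (s ∸ t) * n → ¬ Coprime m n
  where s = fdiv b a

K1Prop : ℕ → ℕ → ℕ → ℕ → Set
K1Prop n b c k =
  (0 < k) ×
  (cdiv ((k ∸ 1) * n) c ≡ cdiv ((k ∸ 1) * n) b) ×
  (∃ λ m → (k * n ≤ m * c) × (m * b < k * n))

IsK1 : ℕ → ℕ → ℕ → ℕ → Set
IsK1 n b c k1 = K1Prop n b c k1 × (∀ k → K1Prop n b c k → k ≤ k1)

module Submission where

open import Defs
open import Data.Nat using (ℕ; _+_; _*_; _∸_; _≤_; _<_)
open import Data.Nat.GCD using (gcd)
open import Data.Nat.Primality using (Prime)
open import Data.Product using (_×_)
open import Data.Sum using (_⊎_)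
open import Relation.Binary.PropositionalEquality using (_≡_; _≢_)

open import Data.Nat using (suc; zero; _%_; s≤s; z≤n)
open import Data.Nat.Properties
open import Data.Nat.DivMod using (m≡m%n+[m/n]*n; m%n<n; m/n*n≤m)
open import Data.Empty using (⊥)
open import Data.Product using (_,_)
open import Relation.Binary.PropositionalEquality using (sym; trans; cong; subst)
open import Data.Nat.Tactic.RingSolver using (solve-∀)

-- Put K = k₁ - 1 and suppose K ≥ 6.  By definition of k₁ the
-- ceilings ⌈Kn/c⌉ and ⌈Kn/b⌉ coincide; two multiples Kn/b ≤ M and Kn/c > M - 1
-- of the same integer M force Kn/b - Kn/c < 1, i.e. Kn(c - b) < bc.  Since
-- c - b = a - 1 ≥ 1 and c < n/2 this gives 2K(a - 1) < b, hence b > 12(a - 1),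
-- while s = ⌊b/a⌋ ≤ 9 gives b < 10a.  Together a - 1 ≤ 4, so b ≤ 49 and
-- c ≤ 53, and then bc ≤ 2597 < 6·1001 ≤ Kn(a - 1), a contradiction.

ceil-upper : ∀ x d → cdiv x (suc d) * suc d ≤ x + d
ceil-upper x d = m/n*n≤m (x + d) (suc d)

ceil-lower : ∀ x d → x ≤ cdiv x (suc d) * suc d
ceil-lower x d = +-cancelʳ-≤ d x (q * suc d) (begin
    x + d                        ≡⟨ m≡m%n+[m/n]*n (x + d) (suc d) ⟩
    (x + d) % suc d + q * suc d  ≤⟨ +-monoˡ-≤ (q * suc d) (<⇒≤pred (m%n<n (x + d) (suc d))) ⟩
    d + q * suc d                ≡⟨ +-comm d (q * suc d) ⟩
    q * suc d + d                ∎)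
  where
  open ≤-Reasoning
  q = cdiv x (suc d)

floor-bound : ∀ x d k → fdiv x (suc d) ≤ k → x < suc k * suc d
floor-bound x d k ⌊x/d⌋≤k = begin-strict
    x                                ≡⟨ m≡m%n+[m/n]*n x (suc d) ⟩
    x % suc d + fdiv x (suc d) * suc d <⟨ +-mono-<-≤ (m%n<n x (suc d)) (*-monoˡ-≤ (suc d) ⌊x/d⌋≤k) ⟩
    suc d + k * suc d                ≡⟨⟩
    suc k * suc d                    ∎
  where open ≤-Reasoning

-- If ⌈x/c⌉ = ⌈x/b⌉ then x/b - x/c < 1, i.e. x·c < x·b + b·c: with M the
-- common ceiling, x·c ≤ M·b·c = M·c·b ≤ (x + c - 1)·b.
equal-ceilings-gap : ∀ x b' c' → cdiv x (suc c') ≡ cdiv x (suc b') →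
                     x * suc c' < x * suc b' + suc b' * suc c'
equal-ceilings-gap x b' c' same = begin-strict
    x * suc c'                     ≤⟨ *-monoˡ-≤ (suc c') x≤M*b ⟩
    M * suc b' * suc c'            ≡⟨ swap M (suc b') (suc c') ⟩
    M * suc c' * suc b'            ≤⟨ *-monoˡ-≤ (suc b') (ceil-upper x c') ⟩
    (x + c') * suc b'              ≡⟨ *-distribʳ-+ (suc b') x c' ⟩
    x * suc b' + c' * suc b'       <⟨ +-monoʳ-< (x * suc b') (*-monoˡ-< (suc b') (n<1+n c')) ⟩
    x * suc b' + suc c' * suc b'   ≡⟨ cong (x * suc b' +_) (*-comm (suc c') (suc b')) ⟩
    x * suc b' + suc b' * suc c'   ∎
  where
  open ≤-Reasoning
  M = cdiv x (suc c')
  x≤M*b : x ≤ M * suc b'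
  x≤M*b = subst (λ m → x ≤ m * suc b') (sym same) (ceil-lower x b')
  swap : ∀ u v w → u * v * w ≡ u * w * v
  swap = solve-∀

equal-ceilings-excess : ∀ x b' e → cdiv x (suc b' + e) ≡ cdiv x (suc b') →
                        x * e < suc b' * (suc b' + e)
equal-ceilings-excess x b' e same =
  +-cancelˡ-< (x * suc b') (x * e) (suc b' * (suc b' + e))
    (subst (_< x * suc b' + suc b' * (suc b' + e))
           (*-distribˡ-+ x (suc b') e)
           (equal-ceilings-gap x b' (b' + e) same))

excess-bound : ∀ n K b c e → K * n * e < b * c → 2 * c < n → 2 * K * e < b
excess-bound n K b c e Kne<bc 2c<n = *-cancelʳ-< n (2 * K * e) b (begin-strict
    2 * K * e * n  ≡⟨ regroup K n e ⟩
    2 * (K * n * e) <⟨ *-monoʳ-< 2 Kne<bc ⟩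
    2 * (b * c)    ≡⟨ pull b c ⟩
    b * (2 * c)    ≤⟨ *-monoʳ-≤ b (<⇒≤ 2c<n) ⟩
    b * n          ∎)
  where
  open ≤-Reasoning
  regroup : ∀ K n e → 2 * K * e * n ≡ 2 * (K * n * e)
  regroup = solve-∀
  pull : ∀ b c → 2 * (b * c) ≡ b * (2 * c)
  pull = solve-∀

excess-small : ∀ b e → 12 * e < b → b < 10 * suc e → e < 5
excess-small b e 12e<b b<10e+10 =
  *-cancelˡ-< 2 e 5 (+-cancelʳ-< (10 * e) (2 * e) 10
    (subst (_< 10 + 10 * e) (split e) (<-trans 12e<b (subst (b <_) (expand e) b<10e+10))))
  where
  split : ∀ e → 12 * e ≡ 2 * e + 10 * e
  split = solve-∀
  expand : ∀ e → 10 * suc e ≡ 10 + 10 * e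
  expand = solve-∀

large-k-impossible : ∀ n K b' e → 6 ≤ K → 1000 < n → 0 < e →
                     2 * (suc b' + e) < n → suc b' < 10 * suc e →
                     cdiv (K * n) (suc b' + e) ≡ cdiv (K * n) (suc b') → ⊥
large-k-impossible n K b' e 6≤K 1000<n 0<e 2c<n b<10a same =
  <⇒≱ Kne<bc (begin
    b * c           ≤⟨ *-mono-≤ b≤49 c≤53 ⟩
    49 * 53         ≤⟨ m≤m+n 2597 3409 ⟩
    6 * 1001 * 1    ≤⟨ *-mono-≤ (*-mono-≤ 6≤K 1000<n) 0<e ⟩
    K * n * e       ∎)
  where
  open ≤-Reasoning
  b = suc b'
  c = suc b' + e
  Kne<bc : K * n * e < b * c
  Kne<bc = equal-ceilings-excess (K * n) b' e same
  12e<b : 12 * e < b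
  12e<b = ≤-<-trans (*-monoˡ-≤ e (*-monoʳ-≤ 2 6≤K)) (excess-bound n K b c e Kne<bc 2c<n)
  e<5 : e < 5
  e<5 = excess-small b e 12e<b b<10a
  b≤49 : b ≤ 49
  b≤49 = <⇒≤pred (<-≤-trans b<10a (*-monoʳ-≤ 10 e<5))
  c≤53 : c ≤ 53
  c≤53 = +-mono-≤ b≤49 (<⇒≤pred e<5)

equal-ceilings-bound : ∀ n a b c K → 1000 < n → 1 + c ≡ a + b → 2 * c < n →
                       1 < a → 0 < b → fdiv b a ≤ 9 →
                       cdiv (K * n) c ≡ cdiv (K * n) b → K < 6
equal-ceilings-bound n (suc e) (suc b') c K 1000<n sum 2c<n (s≤s 0<e) _ s≤9 same =
  ≰⇒> λ 6≤K → large-k-impossible n K b' e 6≤K 1000<n 0<e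
    (subst (λ z → 2 * z < n) c≡b+e 2c<n)
    (floor-bound (suc b') e 9 s≤9)
    (subst (λ z → cdiv (K * n) z ≡ cdiv (K * n) (suc b')) c≡b+e same)
  where
  c≡b+e : c ≡ suc b' + e
  c≡b+e = trans (suc-injective sum) (+-comm e (suc b'))

pred<⇒≤ : ∀ m k → m ∸ 1 < k → m ≤ k
pred<⇒≤ zero    k _   = z≤n
pred<⇒≤ (suc m) k m<k = m<k

lemma5p2 : (p1 p2 p3 n g a b c k1 : ℕ) →
    Prime p1 → Prime p2 → Prime p3 → p1 ≢ p2 → p1 ≢ p3 → p2 ≢ p3 →
    n ≡ p1 * p2 * p3 → gcd n 6 ≡ 1 → 1000 < n →
    HasOrder n g n →
    1 + c ≡ a + b →
    1 < c → 2 * c < n → n < 2 * (n ∸ b) → n ∸ b ≤ n ∸ a → n ∸ a < n ∸ 1 →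
    MinimalZeroSum n (seqS n g a b c 1) →
    Reduced n g a b c →
    (CondA2 p1 p2 p3 n a b c ⊎ CondA3 p1 p2 p3 n a b c ⊎ CondA4 p1 p2 p3 n a b c) →
    fdiv b a ≤ 9 →
    CondB n a b →
    IsK1 n b c k1 →
    cdiv n c ≡ cdiv n b →
    k1 * a ≤ b →
    k1 ≤ 6
lemma5p2 p1 p2 p3 n g a b c k1 _ _ _ _ _ _ _ _ 1000<n _ sum _ 2c<n _ n-b≤n-a n-a<n-1 _ _ _ s≤9 _
         ((_ , same , _) , _) _ _ =
  pred<⇒≤ k1 6 (equal-ceilings-bound n a b c (k1 ∸ 1) 1000<n sum 2c<n 1<a 0<b s≤9 same)
  where
  1<a : 1 < a
  1<a = ∸-cancelʳ-< n-a<n-1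
  0<b : 0 < b
  0<b = ∸-cancelʳ-< {b} {0} {n} (≤-<-trans n-b≤n-a (<-≤-trans n-a<n-1 (m∸n≤m n 1)))
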